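{- Let $K$ be a valued field and $d \geq 1$. Then the family $\operatorname{Conv}_{K^d}$ of convex subsets of $K^d$ has VC-dimension $d+1$.
   Context: $K$ is a field with a valuation $\nu$ and valuation ring $\mathcal{O} = \{x : \nu(x)\ge0\}$. A set $X \subseteq K^d$ is convex if for all $n\ge1$, $x_1,\ldots,x_n \in X$ and $\alpha_1,\ldots,\alpha_n \in \mathcal{O}$ with $\sum \alpha_i = 1$, $\sum\alpha_i x_i \in X$. For a family $\mathcal{F}$ of subsets of a set $X$, $\mathcal{F}$ shatters $Y \subseteq X$ if $\{S \cap Y : S \in \mathcal{F}\} = \mathcal{P}(Y)$; the VC-dimension of $\mathcal{F}$ is the largest $k$ such that $\mathcal{F}$ shatters some $k$-element subset of $X$ (infinite if arbitrarily large finite sets are shattered). -}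

module Defs where

open import Level using (Level; _⊔_; suc)
import Data.Nat as ℕ
open ℕ using (ℕ; _<_)
import Data.Fin as Fin
open Fin using (Fin)
open import Data.Sum using (_⊎_)
import Data.Vec
open import Data.Bool using (Bool; true; false)
open import Data.Maybe using (Maybe; just; nothing)
open import Data.Product using (Σ; _×_; _,_)
open import Data.Empty.Polymorphic using (⊥)
open import Data.Unit.Polymorphic using (⊤)
open import Data.Vec using (Vec; replicate; zipWith)
open import Data.Vec.Relation.Binary.Pointwise.Inductive using (Pointwise)
open import Relation.Nullary using (¬_)
open import Relation.Binary.PropositionalEquality using (_≡_)
open import Function.Bundles using (_⇔_)
open import Algebra.Bundles using (CommutativeRing; AbelianGroup)
open import Relation.Binary.Structures using (IsTotalOrder)

record Field (c ℓ : Level) : Set (suc (c ⊔ ℓ)) where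
  field
    commRing : CommutativeRing c ℓ
  open CommutativeRing commRing public
  field
    0≉1     : ¬ (0# ≈ 1#)
    inverse : ∀ x → ¬ (x ≈ 0#) → Σ Carrier λ y → x * y ≈ 1#

record OrderedAbelianGroup (c ℓ₁ ℓ₂ : Level) : Set (suc (c ⊔ ℓ₁ ⊔ ℓ₂)) where
  field
    abGroup : AbelianGroup c ℓ₁
  open AbelianGroup abGroup public
  field
    _≤_         : Carrier → Carrier → Set ℓ₂
    isTotalOrder : IsTotalOrder _≈_ _≤_
    ≤-compat    : ∀ {a b} c → a ≤ b → (a ∙ c) ≤ (b ∙ c)

-- Γ ∪ {∞}, with ∞ represented by nothing.

module ExtendedValues {c ℓ₁ ℓ₂} (Γ : OrderedAbelianGroup c ℓ₁ ℓ₂) where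
  open OrderedAbelianGroup Γ

  Γ∞ : Set c
  Γ∞ = Maybe Carrier

  _≈∞_ : Γ∞ → Γ∞ → Set ℓ₁
  just a  ≈∞ just b  = a ≈ b
  nothing ≈∞ nothing = ⊤
  _       ≈∞ _       = ⊥

  _≤∞_ : Γ∞ → Γ∞ → Set ℓ₂
  just a  ≤∞ just b  = a ≤ b
  _       ≤∞ nothing = ⊤
  nothing ≤∞ just _  = ⊥

  _+∞_ : Γ∞ → Γ∞ → Γ∞
  just a +∞ just b = just (a ∙ b)
  _      +∞ _      = nothing

record ValuedField (c ℓ g ℓ₁ ℓ₂ : Level) : Set (suc (c ⊔ ℓ ⊔ g ⊔ ℓ₁ ⊔ ℓ₂)) where
  field
    K : Field c ℓ
    Γ : OrderedAbelianGroup g ℓ₁ ℓ₂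
  open Field K public
  open ExtendedValues Γ public
  field
    ν        : Carrier → Γ∞
    ν-cong   : ∀ {x y} → x ≈ y → ν x ≈∞ ν y
    ν-∞      : ∀ x → (ν x ≈∞ nothing) ⇔ (x ≈ 0#)
    ν-mult   : ∀ x y → ν (x * y) ≈∞ (ν x +∞ ν y)
    ν-ultra  : ∀ x y → (ν x ≤∞ ν (x + y)) ⊎ (ν y ≤∞ ν (x + y))

  InO : Carrier → Set ℓ₂
  InO x = just (OrderedAbelianGroup.ε Γ) ≤∞ ν x

module Convexity {c ℓ g ℓ₁ ℓ₂} (V : ValuedField c ℓ g ℓ₁ ℓ₂) where
  open ValuedField V

  Point : ℕ → Set c
  Point d = Vec Carrier d

  _≈ᵥ_ : ∀ {d} → Point d → Point d → Set (c ⊔ ℓ)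
  _≈ᵥ_ = Pointwise _≈_

  ∑ : ∀ {n} → (Fin n → Carrier) → Carrier
  ∑ {ℕ.zero}  f = 0#
  ∑ {ℕ.suc n} f = f Fin.zero + ∑ (λ i → f (Fin.suc i))

  _⊕_ : ∀ {d} → Point d → Point d → Point d
  _⊕_ = zipWith _+_

  _⊙_ : ∀ {d} → Carrier → Point d → Point d
  a ⊙ x = Data.Vec.map (a *_) x

  ∑ᵥ : ∀ {d n} → (Fin n → Point d) → Point d
  ∑ᵥ {d} {ℕ.zero}  f = replicate d 0#
  ∑ᵥ {d} {ℕ.suc n} f = f Fin.zero ⊕ ∑ᵥ (λ i → f (Fin.suc i))

  record Subset (d : ℕ) (p : Level) : Set (c ⊔ ℓ ⊔ suc p) where
    field
      _∋_   : Point d → Set p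
      resp  : ∀ {x y} → x ≈ᵥ y → _∋_ x → _∋_ y

  open Subset public

  IsConvex : ∀ {d p} → Subset d p → Set (c ⊔ ℓ ⊔ ℓ₂ ⊔ p)
  IsConvex {d} X =
    ∀ (n : ℕ) (x : Fin n → Point d) (α : Fin n → Carrier) →
    (∀ i → X ∋ x i) → (∀ i → InO (α i)) → ∑ α ≈ 1# →
    X ∋ ∑ᵥ (λ i → α i ⊙ x i)

-- A family is given by a predicate on subsets; subsets of a finite set
-- Y = {y₁,…,yₖ} are given by Boolean characteristic functions.

module VC {a e s m p : Level} (A : Set a) (_≈A_ : A → A → Set e)
          (Sub : Set s) (_∈S_ : A → Sub → Set p) (Fam : Sub → Set m) where

  -- y : Fin k → A is a k-element subset of A (pairwise distinct points)
  Distinct : ∀ {k} → (Fin k → A) → Set e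
  Distinct y = ∀ i j → y i ≈A y j → i ≡ j

  Shatters : ∀ {k} → (Fin k → A) → Set (s ⊔ m ⊔ p)
  Shatters {k} y = ∀ (T : Fin k → Bool) →
    Σ Sub λ S → Fam S × (∀ i → (y i ∈S S) ⇔ (T i ≡ true))

  ShattersSomeOfSize : ℕ → Set (a ⊔ e ⊔ s ⊔ m ⊔ p)
  ShattersSomeOfSize k = Σ (Fin k → A) λ y → Distinct y × Shatters y

  HasVCDim : ℕ → Set (a ⊔ e ⊔ s ⊔ m ⊔ p)
  HasVCDim n = ShattersSomeOfSize n × (∀ k → n < k → ¬ ShattersSomeOfSize k)

-- Upper bound: among d + 2 points of K^d there is an affine dependence Σ cᵢ (1, yᵢ) = 0.
-- Choosing j with ν(cⱼ) minimal, yⱼ = Σ_{i≠j} (-cᵢ/cⱼ) yᵢ with weights in 𝒪 summing to 1,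
-- so every convex set containing the other points contains yⱼ, and {yᵢ : i ≠ j} is not cut out.
-- Lower bound: the vertices 0, e₁, …, e_d of the standard simplex are shattered by the affine
-- subspaces cut out by their facet hyperplanes, which are convex for any coefficients summing to 1.
module Submission where

open import Defs
open import Level using (Level; _⊔_; Lift; lift; lower)
open import Data.Nat using (ℕ; suc; _<_; _≥_; s≤s)
open import Data.Nat.Properties using (m<n⇒m<1+n)
open import Data.Fin using (Fin; zero; suc; punchIn; _≟_)
open import Data.Fin.Properties using (all?; ¬∀⟶∃¬; punchInᵢ≢i)
open import Data.Bool using (Bool; true; false; not; if_then_else_; T; T?)
open import Data.Maybe using (just; nothing; is-nothing)
open import Data.Product using (∃; _,_; proj₁; proj₂)
open import Data.Sum using (inj₁; inj₂)
open import Data.Empty using (⊥-elim)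
open import Data.Vec using (lookup; replicate; tabulate)
open import Data.Vec.Properties using (lookup-map; lookup-zipWith; lookup-replicate; lookup∘tabulate)
import Data.Vec.Relation.Binary.Pointwise.Inductive as Pointwise
open import Data.Vec.Relation.Binary.Pointwise.Extensional using (ext; extensional⇒inductive)
open import Data.Vec.Functional using (Vector; removeAt; insertAt)
open import Data.Vec.Functional.Properties using (insertAt-lookup; insertAt-punchIn)
open import Function using (_∘_; case_of_)
open import Function.Bundles using (Equivalence; mk⇔)
open import Relation.Nullary using (¬_; Dec; does; yes; no)
open import Relation.Nullary.Decidable using (map′; dec-true; dec-false)
open import Relation.Binary.Bundles using (Preorder)
open import Relation.Binary.Definitions using (Reflexive; Symmetric; Transitive; Total)
open import Relation.Binary.Structures using (IsEquivalence; IsTotalOrder)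
open import Relation.Binary.PropositionalEquality as Eq using (_≡_; _≢_)
import Relation.Binary.Reasoning.Preorder
open import Algebra.Bundles using (CommutativeRing)

module ExtendedValueProperties {c ℓ₁ ℓ₂} (Γ : OrderedAbelianGroup c ℓ₁ ℓ₂) where
  open OrderedAbelianGroup Γ
  open ExtendedValues Γ
  open IsTotalOrder isTotalOrder using (isPreorder; total; antisym)
    renaming (reflexive to ≤-reflexive; trans to ≤-trans)
  open import Algebra.Properties.Group group using (identityˡ-unique)

  ≤-preorder : Preorder c ℓ₁ ℓ₂
  ≤-preorder = record { isPreorder = isPreorder }

  module ≤-Reasoning = Relation.Binary.Reasoning.Preorder ≤-preorder

  ≈∞-refl : Reflexive _≈∞_
  ≈∞-refl {just a}  = refl
  ≈∞-refl {nothing} = _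

  ≈∞-sym : Symmetric _≈∞_
  ≈∞-sym {just a}  {just b}  a≈b = sym a≈b
  ≈∞-sym {nothing} {nothing} _   = _

  ≈∞-trans : Transitive _≈∞_
  ≈∞-trans {just a}  {just b}  {just c}  a≈b b≈c = trans a≈b b≈c
  ≈∞-trans {nothing} {nothing} {nothing} _   _   = _

  ≈∞-isEquivalence : IsEquivalence _≈∞_
  ≈∞-isEquivalence = record
    { refl  = λ {u} → ≈∞-refl {u}
    ; sym   = λ {u} {v} → ≈∞-sym {u} {v}
    ; trans = λ {u} {v} {w} → ≈∞-trans {u} {v} {w}
    }

  ≤∞-reflexive : ∀ {u v} → u ≈∞ v → u ≤∞ v
  ≤∞-reflexive {just a}  {just b}  a≈b = ≤-reflexive a≈b
  ≤∞-reflexive {nothing} {nothing} _   = _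

  ≤∞-trans : Transitive _≤∞_
  ≤∞-trans {just a}  {just b}  {just c}  a≤b b≤c = ≤-trans a≤b b≤c
  ≤∞-trans {just a}  {_}       {nothing} _   _   = _
  ≤∞-trans {nothing} {_}       {nothing} _   _   = _
  ≤∞-trans {just a}  {nothing} {just c}  _   ()
  ≤∞-trans {nothing} {nothing} {just c}  _   ()

  ≤∞-refl : ∀ u → u ≤∞ u
  ≤∞-refl u = ≤∞-reflexive {u} {u} (≈∞-refl {u})

  ≤∞-total : Total _≤∞_
  ≤∞-total (just a)  (just b)  = total a b
  ≤∞-total (just a)  nothing   = inj₁ _
  ≤∞-total nothing   nothing   = inj₁ _
  ≤∞-total nothing   (just b)  = inj₂ _

  ≤∞-preorder : Preorder c ℓ₁ ℓ₂
  ≤∞-preorder = record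
    { isPreorder = record
      { isEquivalence = ≈∞-isEquivalence
      ; reflexive     = λ {u} {v} → ≤∞-reflexive {u} {v}
      ; trans         = λ {u} {v} {w} → ≤∞-trans {u} {v} {w}
      }
    }

  +∞-monoˡ-≤∞ : ∀ {u v} w → u ≤∞ v → (u +∞ w) ≤∞ (v +∞ w)
  +∞-monoˡ-≤∞ {just a}  {just b}  (just c) a≤b = ≤-compat c a≤b
  +∞-monoˡ-≤∞ {just a}  {just b}  nothing  _   = _
  +∞-monoˡ-≤∞ {just a}  {nothing} (just c) _   = _
  +∞-monoˡ-≤∞ {just a}  {nothing} nothing  _   = _
  +∞-monoˡ-≤∞ {nothing} {nothing} w        _   = _

  +∞-congʳ : ∀ w {u v} → u ≈∞ v → (u +∞ w) ≈∞ (v +∞ w)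
  +∞-congʳ (just c) {just a}  {just b}  a≈b = ∙-congʳ a≈b
  +∞-congʳ (just c) {nothing} {nothing} _   = _
  +∞-congʳ nothing  {just a}  {just b}  _   = _
  +∞-congʳ nothing  {nothing} {nothing} _   = _

  ε+∞-identityˡ : ∀ u → (just ε +∞ u) ≈∞ u
  ε+∞-identityˡ (just a) = identityˡ a
  ε+∞-identityˡ nothing  = _

  idempotent⇒ε : ∀ u → u ≈∞ (u +∞ u) → ¬ u ≈∞ nothing → u ≈∞ just ε
  idempotent⇒ε (just a) a≈a∙a _ = identityˡ-unique a a (sym a≈a∙a)
  idempotent⇒ε nothing  _     u≉∞ = ⊥-elim (u≉∞ _)

  2-torsion⇒ε : ∀ u → (u +∞ u) ≈∞ just ε → u ≈∞ just ε
  2-torsion⇒ε (just a) a∙a≈ε with total a ε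
  ... | inj₁ a≤ε = antisym a≤ε (begin
    ε      ≈⟨ a∙a≈ε ⟨
    a ∙ a  ≲⟨ ≤-compat a a≤ε ⟩
    ε ∙ a  ≈⟨ identityˡ a ⟩
    a      ∎)
    where open ≤-Reasoning
  ... | inj₂ ε≤a = antisym (begin
    a      ≈⟨ identityˡ a ⟨
    ε ∙ a  ≲⟨ ≤-compat a ε≤a ⟩
    a ∙ a  ≈⟨ a∙a≈ε ⟩
    ε      ∎) ε≤a
    where open ≤-Reasoning

  argmin : ∀ {n} (f : Fin (suc n) → Γ∞) → ∃ λ j → ∀ i → f j ≤∞ f i
  argmin {ℕ.zero} f = zero , λ { zero → ≤∞-refl (f zero) }
  argmin {suc n}  f with argmin (λ i → f (suc i))
  ... | j , fj≤ with ≤∞-total (f zero) (f (suc j))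
  ... | inj₁ f0≤fj = zero , λ { zero → ≤∞-refl (f zero)
                               ; (suc i) → ≤∞-trans {f zero} {f (suc j)} {f (suc i)} f0≤fj (fj≤ i) }
  ... | inj₂ fj≤f0 = suc j , λ { zero → fj≤f0 ; (suc i) → fj≤ i }

  is-nothing⇒≈∞ : ∀ u → T (is-nothing u) → u ≈∞ nothing
  is-nothing⇒≈∞ nothing _ = _

  ≈∞⇒is-nothing : ∀ u → u ≈∞ nothing → T (is-nothing u)
  ≈∞⇒is-nothing nothing _ = _

  ∞-maximal : ∀ u v → u ≤∞ v → u ≈∞ nothing → v ≈∞ nothing
  ∞-maximal nothing nothing _ _ = _

module ValuationProperties {c ℓ g ℓ₁ ℓ₂} (V : ValuedField c ℓ g ℓ₁ ℓ₂) where
  open ValuedField V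
  open ExtendedValueProperties Γ
  open import Algebra.Properties.Ring ring using (-1*x≈-x; -‿involutive)
  module Γ = OrderedAbelianGroup Γ
  module ≤∞-Reasoning = Relation.Binary.Reasoning.Preorder ≤∞-preorder

  -- Decidable, and in Set whatever the level of _≈_.
  IsZero : Carrier → Set
  IsZero x = T (is-nothing (ν x))

  IsZero⇒≈0 : ∀ {x} → IsZero x → x ≈ 0#
  IsZero⇒≈0 {x} = Equivalence.to (ν-∞ x) ∘ is-nothing⇒≈∞ (ν x)

  ≈0⇒IsZero : ∀ {x} → x ≈ 0# → IsZero x
  ≈0⇒IsZero {x} = ≈∞⇒is-nothing (ν x) ∘ Equivalence.from (ν-∞ x)

  ≈0? : ∀ x → Dec (x ≈ 0#)
  ≈0? x = map′ IsZero⇒≈0 ≈0⇒IsZero (T? (is-nothing (ν x)))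

  ν-1# : ν 1# ≈∞ just Γ.ε
  ν-1# = idempotent⇒ε (ν 1#) ν1≈ν1+ν1 (λ ν1≈∞ → 0≉1 (sym (Equivalence.to (ν-∞ 1#) ν1≈∞)))
    where
      open ≤∞-Reasoning
      ν1≈ν1+ν1 : ν 1# ≈∞ (ν 1# +∞ ν 1#)
      ν1≈ν1+ν1 = begin-equality
        ν 1#            ≈⟨ ν-cong (*-identityˡ 1#) ⟨
        ν (1# * 1#)     ≈⟨ ν-mult 1# 1# ⟩
        ν 1# +∞ ν 1#    ∎

  ν-‿1# : ν (- 1#) ≈∞ just Γ.ε
  ν-‿1# = 2-torsion⇒ε (ν (- 1#)) (begin-equality
    ν (- 1#) +∞ ν (- 1#)  ≈⟨ ν-mult (- 1#) (- 1#) ⟨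
    ν (- 1# * - 1#)       ≈⟨ ν-cong (trans (-1*x≈-x (- 1#)) (-‿involutive 1#)) ⟩
    ν 1#                  ≈⟨ ν-1# ⟩
    just Γ.ε              ∎)
    where open ≤∞-Reasoning

  ν-‿ : ∀ x → ν (- x) ≈∞ ν x
  ν-‿ x = begin-equality
    ν (- x)              ≈⟨ ν-cong (-1*x≈-x x) ⟨
    ν (- 1# * x)         ≈⟨ ν-mult (- 1#) x ⟩
    ν (- 1#) +∞ ν x      ≈⟨ +∞-congʳ (ν x) {ν (- 1#)} ν-‿1# ⟩
    just Γ.ε +∞ ν x      ≈⟨ ε+∞-identityˡ (ν x) ⟩
    ν x                  ∎
    where open ≤∞-Reasoning

  ν-‿-monoˡ-≤∞ : ∀ {x y} → ν x ≤∞ ν y → ν (- x) ≤∞ ν y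
  ν-‿-monoˡ-≤∞ {x} {y} νx≤νy = begin
    ν (- x)  ≈⟨ ν-‿ x ⟩
    ν x      ≲⟨ νx≤νy ⟩
    ν y      ∎
    where open ≤∞-Reasoning

  ∈𝒪-quotient : ∀ {x y b} → ν x ≤∞ ν y → x * b ≈ 1# → InO (y * b)
  ∈𝒪-quotient {x} {y} {b} νx≤νy xb≈1 = begin
    just Γ.ε      ≈⟨ ν-1# ⟨
    ν 1#          ≈⟨ ν-cong xb≈1 ⟨
    ν (x * b)     ≈⟨ ν-mult x b ⟩
    ν x +∞ ν b    ≲⟨ +∞-monoˡ-≤∞ {ν x} {ν y} (ν b) νx≤νy ⟩
    ν y +∞ ν b    ≈⟨ ν-mult y b ⟨
    ν (y * b)     ∎
    where open ≤∞-Reasoning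

  νx≤νy∧x≈0⇒y≈0 : ∀ {x y} → ν x ≤∞ ν y → x ≈ 0# → y ≈ 0#
  νx≤νy∧x≈0⇒y≈0 {x} {y} νx≤νy x≈0 =
    Equivalence.to (ν-∞ y) (∞-maximal (ν x) (ν y) νx≤νy (Equivalence.from (ν-∞ x) x≈0))

module CommutativeRingSums {c ℓ} (R : CommutativeRing c ℓ) where
  open CommutativeRing R
  open import Algebra.Properties.Ring ring using (-‿distribˡ-*; +-inverseʳ-unique)
  open import Algebra.Properties.Semiring.Sum semiring public
  open import Algebra.Solver.Ring.NaturalCoefficients.Default commutativeSemiring
    using (solve; _:+_; _:*_; _:=_)
  open import Relation.Binary.Reasoning.Setoid setoid

  sum-zero : ∀ {n} {f : Fin n → Carrier} → (∀ i → f i ≈ 0#) → sum f ≈ 0#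
  sum-zero {n} f≈0 = trans (sum-cong-≋ f≈0) (sum-replicate-zero n)

  solve-for : ∀ {n} (c w : Vector Carrier (suc n)) j {b} →
              - c j * b ≈ 1# → sum (λ i → c i * w i) ≈ 0# →
              sum (λ i → (removeAt c j i * b) * removeAt w j i) ≈ w j
  solve-for c w j {b} -cⱼb≈1 ∑cw≈0 = begin
    sum (λ i → (c′ i * b) * w′ i)
      ≈⟨ sum-cong-≋ (λ i → solve 3 (λ x b y → (x :* b) :* y := b :* (x :* y)) refl
                                   (c′ i) b (w′ i)) ⟩
    sum (λ i → b * (c′ i * w′ i))  ≈⟨ *-distribˡ-sum b (λ i → c′ i * w′ i) ⟨
    b * sum (λ i → c′ i * w′ i)    ≈⟨ *-congˡ others≈ ⟩
    b * (- c j * w j)              ≈⟨ *-assoc b (- c j) (w j) ⟨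
    (b * - c j) * w j              ≈⟨ *-congʳ (trans (*-comm b (- c j)) -cⱼb≈1) ⟩
    1# * w j                       ≈⟨ *-identityˡ (w j) ⟩
    w j                            ∎
    where
      c′ = removeAt c j
      w′ = removeAt w j
      others≈ : sum (λ i → c′ i * w′ i) ≈ - c j * w j
      others≈ = trans (+-inverseʳ-unique (c j * w j) _ cⱼwⱼ+others≈0) (-‿distribˡ-* (c j) (w j))
        where
          cⱼwⱼ+others≈0 : c j * w j + sum (λ i → c′ i * w′ i) ≈ 0#
          cⱼwⱼ+others≈0 = trans (sym (sum-remove {i = j} (λ i → c i * w i))) ∑cw≈0

  -- Gaussian elimination of column j of b, using the pivot entry a j.
  eliminate : ∀ {n} → Vector Carrier (suc n) → Fin (suc n) → Vector Carrier (suc n) → Vector Carrier n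
  eliminate a j b i = a j * removeAt b j i + - removeAt a j i * b j

  eliminate-pivot-row : ∀ {n} (a : Vector Carrier (suc n)) j i → eliminate a j a i ≈ 0#
  eliminate-pivot-row a j i = begin
    a j * a′ + - a′ * a j    ≈⟨ +-congˡ (-‿distribˡ-* a′ (a j)) ⟨
    a j * a′ + - (a′ * a j)  ≈⟨ +-congʳ (*-comm (a j) a′) ⟩
    a′ * a j + - (a′ * a j)  ≈⟨ -‿inverseʳ (a′ * a j) ⟩
    0#                       ∎
    where a′ = removeAt a j i

  backSubstitute : ∀ {n} → Vector Carrier (suc n) → Fin (suc n) → Vector Carrier n → Vector Carrier (suc n)
  backSubstitute a j c = insertAt (λ i → a j * c i) j (sum (λ i → c i * - removeAt a j i))

  backSubstitute-row : ∀ {n} (a : Vector Carrier (suc n)) j c b →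
                       sum (λ l → backSubstitute a j c l * b l) ≈
                       sum (λ i → c i * eliminate a j b i)
  backSubstitute-row a j c b = begin
    sum (λ l → c′ l * b l)
      ≈⟨ sum-remove {i = j} (λ l → c′ l * b l) ⟩
    c′ j * b j + sum (λ i → c′ (punchIn j i) * b′ i)
      ≈⟨ +-cong (*-congʳ (reflexive (insertAt-lookup _ j _)))
                (sum-cong-≋ λ i → *-congʳ (reflexive (insertAt-punchIn _ j _ i))) ⟩
    s * b j + sum (λ i → (a j * c i) * b′ i)
      ≈⟨ +-comm _ _ ⟩
    sum (λ i → (a j * c i) * b′ i) + s * b j
      ≈⟨ +-congˡ (*-distribʳ-sum (b j) (λ i → c i * - a′ i)) ⟩
    sum (λ i → (a j * c i) * b′ i) + sum (λ i → (c i * - a′ i) * b j)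
      ≈⟨ ∑-distrib-+ (λ i → (a j * c i) * b′ i) (λ i → (c i * - a′ i) * b j) ⟨
    sum (λ i → (a j * c i) * b′ i + (c i * - a′ i) * b j)
      ≈⟨ sum-cong-≋ (λ i → solve 5 (λ aⱼ cᵢ bᵢ -aᵢ bⱼ → (aⱼ :* cᵢ) :* bᵢ :+ (cᵢ :* -aᵢ) :* bⱼ
                                                    := cᵢ :* (aⱼ :* bᵢ :+ -aᵢ :* bⱼ))
                                      refl (a j) (c i) (b′ i) (- a′ i) (b j)) ⟩
    sum (λ i → c i * eliminate a j b i)
      ∎
    where
      c′ = backSubstitute a j c
      a′ = removeAt a j
      b′ = removeAt b j
      s  = sum (λ i → c i * - a′ i)

module HomogeneousSystem {c ℓ} (F : Field c ℓ) (≈0? : ∀ x → Dec (Field._≈_ F x (Field.0# F))) where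
  open Field F hiding (zero)
  open CommutativeRingSums commRing
  open import Relation.Binary.Reasoning.Setoid setoid

  *-nonzero : ∀ {x y} → ¬ x ≈ 0# → ¬ y ≈ 0# → ¬ x * y ≈ 0#
  *-nonzero {x} {y} x≉0 y≉0 xy≈0 with inverse x x≉0
  ... | x⁻¹ , xx⁻¹≈1 = y≉0 (begin
    y              ≈⟨ *-identityˡ y ⟨
    1# * y         ≈⟨ *-congʳ (trans (*-comm x⁻¹ x) xx⁻¹≈1) ⟨
    (x⁻¹ * x) * y  ≈⟨ *-assoc x⁻¹ x y ⟩
    x⁻¹ * (x * y)  ≈⟨ *-congˡ xy≈0 ⟩
    x⁻¹ * 0#       ≈⟨ zeroʳ x⁻¹ ⟩
    0#             ∎)

  record NontrivialSolution {m n} (A : Fin m → Fin n → Carrier) : Set (c ⊔ ℓ) where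
    field
      solution : Fin n → Carrier
      support  : Fin n
      solution-support≉0 : ¬ solution support ≈ 0#
      solves   : ∀ r → sum (λ i → solution i * A r i) ≈ 0#

  nontrivialSolution : ∀ {m n} → m < n → (A : Fin m → Fin n → Carrier) → NontrivialSolution A
  nontrivialSolution {ℕ.zero} {suc n} _ A = record
    { solution           = λ _ → 1#
    ; support            = zero
    ; solution-support≉0 = λ 1≈0 → 0≉1 (sym 1≈0)
    ; solves             = λ ()
    }
  nontrivialSolution {suc m} {suc n} (s≤s m<n) A with all? (λ i → ≈0? (A zero i))
  ... | yes pivot-row≈0 = record
    { solution           = solution
    ; support            = support
    ; solution-support≉0 = solution-support≉0
    ; solves             = λ
        { zero    → sum-zero (λ i → trans (*-congˡ (pivot-row≈0 i)) (zeroʳ (solution i)))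
        ; (suc r) → solves r
        }
    }
    where open NontrivialSolution (nontrivialSolution (m<n⇒m<1+n m<n) (λ r → A (suc r)))
  ... | no pivot-row≉0 with ¬∀⟶∃¬ _ _ (λ i → ≈0? (A zero i)) pivot-row≉0
  ... | j , aⱼ≉0 = record
    { solution           = backSubstitute a j solution
    ; support            = punchIn j support
    ; solution-support≉0 = λ ≈0 → *-nonzero aⱼ≉0 solution-support≉0
                             (trans (reflexive (Eq.sym (insertAt-punchIn _ j _ support))) ≈0)
    ; solves             = λ r → trans (backSubstitute-row a j solution (A r)) (eliminated r)
    }
    where
      a = A zero
      open NontrivialSolution (nontrivialSolution m<n (λ r → eliminate a j (A (suc r))))
      eliminated : ∀ r → sum (λ i → solution i * eliminate a j (A r) i) ≈ 0#
      eliminated zero    = sum-zero (λ i → trans (*-congˡ (eliminate-pivot-row a j i)) (zeroʳ _))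
      eliminated (suc r) = solves r

module ConvexGeometry {a ℓ g ℓ₁ ℓ₂} (V : ValuedField a ℓ g ℓ₁ ℓ₂) where
  open ValuedField V hiding (zero)
  open Convexity V
  open ExtendedValueProperties Γ
  open ValuationProperties V
  open CommutativeRingSums commRing
  open HomogeneousSystem K ≈0?
  open import Algebra.Properties.Ring ring using (x∙y⁻¹≈ε⇒x≈y; x≈y⇒x∙y⁻¹≈ε)
  open import Relation.Binary.Reasoning.Setoid setoid

  ∑≡sum : ∀ {n} (f : Fin n → Carrier) → ∑ f ≡ sum f
  ∑≡sum {ℕ.zero} f = Eq.refl
  ∑≡sum {suc n}  f = Eq.cong (f zero +_) (∑≡sum (f ∘ suc))

  lookup-∑ᵥ : ∀ {d n} (f : Fin n → Point d) r → lookup (∑ᵥ f) r ≡ sum (λ i → lookup (f i) r)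
  lookup-∑ᵥ {d} {ℕ.zero} f r = lookup-replicate r 0#
  lookup-∑ᵥ {d} {suc n}  f r = Eq.trans (lookup-zipWith _+_ r (f zero) (∑ᵥ (f ∘ suc)))
                                        (Eq.cong (lookup (f zero) r +_) (lookup-∑ᵥ (f ∘ suc) r))

  lookup-combination : ∀ {d n} (α : Fin n → Carrier) (x : Fin n → Point d) r →
                       lookup (∑ᵥ (λ i → α i ⊙ x i)) r ≈ sum (λ i → α i * lookup (x i) r)
  lookup-combination α x r = trans (reflexive (lookup-∑ᵥ (λ i → α i ⊙ x i) r))
                                   (sum-cong-≋ (λ i → reflexive (lookup-map r (α i *_) (x i))))

  record ConvexCombination {d n} (x : Fin n → Point d) (y : Point d) : Set (a ⊔ ℓ ⊔ ℓ₂) where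
    field
      weight        : Fin n → Carrier
      weight∈𝒪      : ∀ i → InO (weight i)
      ∑weight≈1     : ∑ weight ≈ 1#
      combination≈ : ∑ᵥ (λ i → weight i ⊙ x i) ≈ᵥ y

  ∈-convexCombination : ∀ {d n p} {X : Subset d p} {x : Fin n → Point d} {y} →
                        IsConvex X → (∀ i → X ∋ x i) → ConvexCombination x y → X ∋ y
  ∈-convexCombination {n = n} {X = X} {x} X-convex x∈X y≈ =
    resp X combination≈ (X-convex n x weight x∈X weight∈𝒪 ∑weight≈1)
    where open ConvexCombination y≈

  homogenize : ∀ {d} → Point d → Fin (suc d) → Carrier
  homogenize y zero    = 1#
  homogenize y (suc r) = lookup y r

  dependentPoint : ∀ {d n} → d < n → (y : Fin (suc n) → Point d) →
                   ∃ λ j → ConvexCombination (removeAt y j) (y j)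
  dependentPoint {n = n} d<n y = j , record
    { weight       = weight
    ; weight∈𝒪     = λ i → ∈𝒪-quotient (-cⱼ-minimal (punchIn j i)) -cⱼb≈1
    ; ∑weight≈1    = begin
        ∑ weight                     ≡⟨ ∑≡sum weight ⟩
        sum weight                   ≈⟨ sum-cong-≋ (λ i → *-identityʳ (weight i)) ⟨
        sum (λ i → weight i * 1#)    ≈⟨ solved zero ⟩
        1#                           ∎
    ; combination≈ = extensional⇒inductive (ext λ r →
        trans (lookup-combination weight (removeAt y j) r) (solved (suc r)))
    }
    where
      open NontrivialSolution (nontrivialSolution (s≤s d<n) (λ r i → homogenize (y i) r))
      c = solution
      j : Fin (suc n)
      j = proj₁ (argmin (ν ∘ c))
      -cⱼ-minimal : ∀ i → ν (- c j) ≤∞ ν (c i)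
      -cⱼ-minimal i = ν-‿-monoˡ-≤∞ (proj₂ (argmin (ν ∘ c)) i)
      -cⱼ≉0 : ¬ - c j ≈ 0#
      -cⱼ≉0 = solution-support≉0 ∘ νx≤νy∧x≈0⇒y≈0 (-cⱼ-minimal support)
      b : Carrier
      b = proj₁ (inverse (- c j) -cⱼ≉0)
      -cⱼb≈1 : - c j * b ≈ 1#
      -cⱼb≈1 = proj₂ (inverse (- c j) -cⱼ≉0)
      weight : Fin n → Carrier
      weight i = removeAt c j i * b
      solved : ∀ r → sum (λ i → weight i * homogenize (removeAt y j i) r) ≈ homogenize (y j) r
      solved r = solve-for c (λ i → homogenize (y i) r) j -cⱼb≈1 (solves r)

  IsLinear : ∀ {d} → (Point d → Carrier) → Set (a ⊔ ℓ)
  IsLinear {d} φ = ∀ {n} (α : Fin n → Carrier) (x : Fin n → Point d) →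
    φ (∑ᵥ (λ i → α i ⊙ x i)) ≈ sum (λ i → α i * φ (x i))

  record LevelSet (d : ℕ) : Set (a ⊔ ℓ) where
    field
      functional        : Point d → Carrier
      value             : Carrier
      functional-cong   : ∀ {x y} → x ≈ᵥ y → functional x ≈ functional y
      functional-linear : IsLinear functional

  open LevelSet

  _∈ₗ_ : ∀ {d} → Point d → LevelSet d → Set ℓ
  y ∈ₗ H = functional H y ≈ value H

  combination-∈ₗ : ∀ {d n} (H : LevelSet d) (α : Fin n → Carrier) (x : Fin n → Point d) →
                   sum α ≈ 1# → (∀ i → x i ∈ₗ H) → ∑ᵥ (λ i → α i ⊙ x i) ∈ₗ H
  combination-∈ₗ H α x ∑α≈1 x∈H = begin
    functional H (∑ᵥ (λ i → α i ⊙ x i))  ≈⟨ functional-linear H α x ⟩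
    sum (λ i → α i * functional H (x i))  ≈⟨ sum-cong-≋ (λ i → *-congˡ (x∈H i)) ⟩
    sum (λ i → α i * value H)             ≈⟨ *-distribʳ-sum (value H) α ⟨
    sum α * value H                       ≈⟨ *-congʳ ∑α≈1 ⟩
    1# * value H                          ≈⟨ *-identityˡ (value H) ⟩
    value H                               ∎

  _∈₀_ : ∀ {d} → Point d → LevelSet d → Set
  y ∈₀ H = IsZero (functional H y - value H)

  ∈₀⇒∈ₗ : ∀ {d} (H : LevelSet d) {y} → y ∈₀ H → y ∈ₗ H
  ∈₀⇒∈ₗ H = x∙y⁻¹≈ε⇒x≈y _ _ ∘ IsZero⇒≈0

  ∈ₗ⇒∈₀ : ∀ {d} (H : LevelSet d) {y} → y ∈ₗ H → y ∈₀ H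
  ∈ₗ⇒∈₀ H = ≈0⇒IsZero ∘ x≈y⇒x∙y⁻¹≈ε

  coordinateLevelSet : ∀ {d} → Fin d → LevelSet d
  coordinateLevelSet r = record
    { functional        = λ y → lookup y r
    ; value             = 0#
    ; functional-cong   = λ x≈y → Pointwise.lookup x≈y r
    ; functional-linear = λ α x → lookup-combination α x r
    }

  sumLevelSet : ∀ {d} → LevelSet d
  sumLevelSet = record
    { functional        = λ y → sum (lookup y)
    ; value             = 1#
    ; functional-cong   = λ x≈y → sum-cong-≋ (Pointwise.lookup x≈y)
    ; functional-linear = λ α x → begin
        sum (lookup (∑ᵥ (λ i → α i ⊙ x i)))
          ≈⟨ sum-cong-≋ (lookup-combination α x) ⟩
        sum (λ r → sum (λ i → α i * lookup (x i) r))
          ≈⟨ ∑-comm (λ r i → α i * lookup (x i) r) ⟩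
        sum (λ i → sum (λ r → α i * lookup (x i) r))
          ≈⟨ sum-cong-≋ (λ i → *-distribˡ-sum (α i) (lookup (x i))) ⟨
        sum (λ i → α i * sum (lookup (x i)))
          ∎
    }

  unitVector : ∀ {d} → Fin d → Point d
  unitVector j = tabulate (λ r → if does (j ≟ r) then 1# else 0#)

  lookup-unitVector-≡ : ∀ {d} (j : Fin d) → lookup (unitVector j) j ≈ 1#
  lookup-unitVector-≡ j = reflexive (Eq.trans (lookup∘tabulate _ j)
    (Eq.cong (if_then 1# else 0#) (dec-true (j ≟ j) Eq.refl)))

  lookup-unitVector-≢ : ∀ {d} (j r : Fin d) → j ≢ r → lookup (unitVector j) r ≈ 0#
  lookup-unitVector-≢ j r j≢r = reflexive (Eq.trans (lookup∘tabulate _ r)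
    (Eq.cong (if_then 1# else 0#) (dec-false (j ≟ r) j≢r)))

  sum-unitVector : ∀ {d} (j : Fin d) → sum (lookup (unitVector j)) ≈ 1#
  sum-unitVector {suc d} j = begin
    sum e                       ≈⟨ sum-remove {i = j} e ⟩
    e j + sum (removeAt e j)    ≈⟨ +-cong (lookup-unitVector-≡ j) (sum-zero off-diagonal) ⟩
    1# + 0#                     ≈⟨ +-identityʳ 1# ⟩
    1#                          ∎
    where
      e = lookup (unitVector j)
      off-diagonal : ∀ i → removeAt e j i ≈ 0#
      off-diagonal i = lookup-unitVector-≢ j (punchIn j i) (λ j≡ → punchInᵢ≢i j i (Eq.sym j≡))

  vertex : ∀ {d} → Fin (suc d) → Point d
  vertex {d} zero = replicate d 0#
  vertex (suc j)   = unitVector j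

  facet : ∀ {d} → Fin (suc d) → LevelSet d
  facet zero    = sumLevelSet
  facet (suc r) = coordinateLevelSet r

  vertex∈facet : ∀ {d} (k i : Fin (suc d)) → k ≢ i → vertex i ∈ₗ facet k
  vertex∈facet zero    zero    0≢0 = ⊥-elim (0≢0 Eq.refl)
  vertex∈facet zero    (suc j) _   = sum-unitVector j
  vertex∈facet (suc r) zero    _   = reflexive (lookup-replicate r 0#)
  vertex∈facet (suc r) (suc j) r≢j = lookup-unitVector-≢ j r (λ { Eq.refl → r≢j Eq.refl })

  vertex∉facet : ∀ {d} (i : Fin (suc d)) → ¬ vertex i ∈ₗ facet i
  vertex∉facet {d} zero ∑0≈1 = 0≉1 (trans (sym ∑0≈0) ∑0≈1)
    where
      ∑0≈0 : sum (lookup (replicate d 0#)) ≈ 0#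
      ∑0≈0 = sum-zero (λ r → reflexive (lookup-replicate {n = d} r 0#))
  vertex∉facet (suc j) eⱼⱼ≈0 = 0≉1 (sym (trans (sym (lookup-unitVector-≡ j)) eⱼⱼ≈0))

  module Shattering (p : Level) (d : ℕ) where
    open VC (Point d) _≈ᵥ_ (Subset d p) (λ x X → X ∋ x) IsConvex

    -- Stated with _∈₀_ rather than _∈ₗ_ so that membership can be lifted to level p.
    Cut : ∀ {m} → (Fin m → LevelSet d) → (Fin m → Bool) → Subset d p
    Cut H keep = record
      { _∋_  = λ y → Lift p (∀ k → keep k ≡ false → y ∈₀ H k)
      ; resp = λ x≈y x∈ → lift λ k k∉ →
                 ∈ₗ⇒∈₀ (H k) (trans (sym (functional-cong (H k) x≈y)) (∈₀⇒∈ₗ (H k) (lower x∈ k k∉)))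
      }

    Cut-convex : ∀ {m} (H : Fin m → LevelSet d) keep → IsConvex (Cut H keep)
    Cut-convex H keep n x α x∈ _ ∑α≈1 = lift λ k k∉ → ∈ₗ⇒∈₀ (H k)
      (combination-∈ₗ (H k) α x (trans (reflexive (Eq.sym (∑≡sum α))) ∑α≈1)
                      (λ i → ∈₀⇒∈ₗ (H k) (lower (x∈ i) k k∉)))

    simplex-shattered : ∀ {m} (P : Fin m → Point d) (H : Fin m → LevelSet d) →
                        (∀ k i → k ≢ i → P i ∈ₗ H k) → (∀ i → ¬ P i ∈ₗ H i) →
                        ShattersSomeOfSize m
    simplex-shattered {m} P H on off = P , distinct , λ keep →
      Cut H keep , Cut-convex H keep , λ i → mk⇔ (kept keep i ∘ lower) (lift ∘ in-cut keep i)
      where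
        distinct : Distinct P
        distinct i i′ Pᵢ≈Pᵢ′ with i ≟ i′
        ... | yes i≡i′ = i≡i′
        ... | no  i≢i′ = ⊥-elim (off i (trans (functional-cong (H i) Pᵢ≈Pᵢ′) (on i i′ i≢i′)))
        kept : ∀ (keep : Fin m → Bool) i → (∀ k → keep k ≡ false → P i ∈₀ H k) → keep i ≡ true
        kept keep i Pᵢ∈ with keep i in keepᵢ
        ... | true  = Eq.refl
        ... | false = ⊥-elim (off i (∈₀⇒∈ₗ (H i) (Pᵢ∈ i keepᵢ)))
        in-cut : ∀ (keep : Fin m → Bool) i → keep i ≡ true → ∀ k → keep k ≡ false → P i ∈₀ H k
        in-cut keep i keepᵢ k keepₖ =
          ∈ₗ⇒∈₀ (H k) (on k i λ { Eq.refl → case Eq.trans (Eq.sym keepᵢ) keepₖ of λ () })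

    hull-point-not-shattered : ∀ {n} (y : Fin (suc n) → Point d) j →
                               ConvexCombination (removeAt y j) (y j) → ¬ Shatters y
    hull-point-not-shattered y j yⱼ∈hull shatters with shatters (λ i → not (does (i ≟ j)))
    ... | X , X-convex , X∋⇔ = yⱼ∉X (∈-convexCombination {X = X} X-convex others∈X yⱼ∈hull)
      where
        others∈X : ∀ i → X ∋ removeAt y j i
        others∈X i = Equivalence.from (X∋⇔ (punchIn j i))
                       (Eq.cong not (dec-false (punchIn j i ≟ j) (punchInᵢ≢i j i)))
        yⱼ∉X : ¬ X ∋ y j
        yⱼ∉X yⱼ∈X with j ≟ j | Equivalence.to (X∋⇔ j) yⱼ∈X
        ... | yes _   | ()
        ... | no j≢j | _ = j≢j Eq.refl

    no-large-set-shattered : ∀ k → suc d < k → ¬ ShattersSomeOfSize k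
    no-large-set-shattered (suc n) (s≤s d<n) (y , _ , shatters) =
      hull-point-not-shattered y (proj₁ dependent) (proj₂ dependent) shatters
      where
        dependent : ∃ λ j → ConvexCombination (removeAt y j) (y j)
        dependent = dependentPoint d<n y

-- The argument also covers d = 0.
theorem4p8 : ∀ {c ℓ g ℓ₁ ℓ₂ : Level} (p : Level) (V : ValuedField c ℓ g ℓ₁ ℓ₂) (d : ℕ) → d ≥ 1 →
    let open Convexity V in
    VC.HasVCDim (Point d) _≈ᵥ_ (Subset d p) (λ x X → X ∋ x) IsConvex (suc d)
theorem4p8 p V d _ =
  simplex-shattered vertex facet vertex∈facet vertex∉facet , no-large-set-shattered
  where
    open ConvexGeometry V
    open Shattering p d
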